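{- For every positive integer $n$, $$\Phi^{(1)}[a; b, b'; cq^{ -n}; x, y] = \frac{1}{(q/c; q)_n} \sum_{k=0}^n \begin{bmatrix} n \\ k \end{bmatrix} (-c)^{k-n} q^{\binom{n+1-k}{2}} \Phi^{(1)}[a; b, b'; c; xq^k, yq^k],$$ and $$\Phi^{(1)}[a; b, b'; cq^n; x, y] = \sum_{k=0}^n \begin{bmatrix} n \\ k \end{bmatrix} c^k q^{2\binom{k}{2}} (cq^k; q)_{n-k}\, \Phi^{(1)}[a; b, b'; cq^k; xq^k, yq^k].$$
   Context: Let $q$ be a complex number with $|q|<1$. For a complex number $z$ and an integer $N\ge 0$, $(z;q)_N=\prod_{j=0}^{N-1}(1-zq^j)$. The $q$-binomial coefficient is $\begin{bmatrix} n \\ k \end{bmatrix}=\frac{(q;q)_n}{(q;q)_k(q;q)_{n-k}}$ for $0\le k\le n$, and $\binom{k}{2}=k(k-1)/2$. The $q$-Appell function $\Phi^{(1)}$ is $$\Phi^{(1)}[a; b, b'; c; x, y] = \sum_{m, n \geq 0} \frac{(a; q)_{m+n} (b; q)_m (b'; q)_n}{(q; q)_m (q; q)_n (c; q)_{m+n}} x^m y^n .$$ All identities are understood as identities of power series in $x,y$ (convergent for $|x|,|y|$ sufficiently small), with parameters generic so that no denominator appearing vanishes. -}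

module Defs where

open import Level using (Level; _⊔_) renaming (suc to lsuc)
open import Algebra.Bundles using (CommutativeRing)
open import Data.Nat using (ℕ; zero; suc; _∸_) renaming (_+_ to _+ℕ_)
open import Relation.Nullary using (¬_)

-- A field: a commutative ring with an inverse operation that is a genuine
-- multiplicative inverse on every nonzero element (value on 0 irrelevant).
record Field (c ℓ : Level) : Set (lsuc (c ⊔ ℓ)) where
  field
    commutativeRing : CommutativeRing c ℓ
  open CommutativeRing commutativeRing public
  infix 8 _⁻¹
  field
    _⁻¹        : Carrier → Carrier
    ⁻¹-inverse : ∀ x → ¬ (x ≈ 0#) → x * (x ⁻¹) ≈ 1#

module _ {c ℓ : Level} (F : Field c ℓ) where
  open Field F hiding (zero)

  pow : Carrier → ℕ → Carrier
  pow x zero    = 1#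
  pow x (suc n) = x * pow x n

  poch : Carrier → Carrier → ℕ → Carrier
  poch z q zero    = 1#
  poch z q (suc N) = poch z q N * (1# - z * pow q N)

  -- q-binomial coefficient [n k] = (q;q)_n / ((q;q)_k (q;q)_{n-k})  (used for 0 ≤ k ≤ n)
  qbinom : Carrier → ℕ → ℕ → Carrier
  qbinom q n k = poch q q n * (poch q q k * poch q q (n ∸ k)) ⁻¹

  -- formal power series in two variables x, y: coefficient of x^m y^l
  Series : Set c
  Series = ℕ → ℕ → Carrier

  _≈ₛ_ : Series → Series → Set ℓ
  S ≈ₛ T = ∀ m l → S m l ≈ T m l

  _·ₛ_ : Carrier → Series → Series
  (t ·ₛ S) m l = t * S m l

  sumₛ : ℕ → (ℕ → Series) → Series
  sumₛ zero    f m l = f zero m l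
  sumₛ (suc n) f m l = sumₛ n f m l + f (suc n) m l

  -- substitution x ↦ t x, y ↦ t y :  S(tx, ty)
  dilate : Carrier → Series → Series
  dilate t S m l = pow t m * pow t l * S m l

  Φ1 : (q a b b' γ : Carrier) → Series
  Φ1 q a b b' γ m l =
    poch a q (m +ℕ l) * poch b q m * poch b' q l
      * (poch q q m * poch q q l * poch γ q (m +ℕ l)) ⁻¹

module Submission where

-- Both sides are formal power series in x, y, so it suffices to compare the coefficients
-- of x^m y^l.  As a function of the lower parameter d this coefficient has the shape
-- coeff(d) = numerator / ((q;q)_m (q;q)_l (d;q)_{m+l}), and substituting q^k x, q^k y
-- multiplies it by Z^k with Z = q^{m+l}.  The whole argument rests on one contiguity
-- relation,  coeff(dq) (1 - dZ) = (1 - d) coeff(d),  combined with two finite q-series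
-- identities, each proved by induction through the q-Pascal rule:
--   * lowering c to c q^{-n}: iterating contiguity n times relates coeff(c q^{-n}) to
--     coeff(c) by a ratio of Pochhammer products, which the q-binomial theorem (Rothe)
--     expands into the stated sum;
--   * raising c to c q^n: any sequence obeying the contiguity recursion expands as
--     Σ_k [n,k] c^k q^{2C(k,2)} (cq^k;q)_{n-k} Z^k G_k  (raising-expansion).

open import Defs
open import Level using (Level)
open import Data.Nat using (ℕ; suc; _≤_; _∸_) renaming (_+_ to _+ℕ_; _*_ to _*ℕ_)
open import Data.Nat.Combinatorics using (_C_)
open import Data.Product using (_×_)
open import Relation.Nullary using (¬_)

open import Algebra.Bundles using (CommutativeRing)
open import Algebra.Solver.Ring.AlmostCommutativeRing
  using (fromCommutativeRing; _-Raw-AlmostCommutative⟶_)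
open import Data.Integer as ℤ using (ℤ; +_; -[1+_])
import Data.Integer.Properties as ℤP
open import Data.Nat as ℕ using (zero)
import Data.Nat.Combinatorics as ℕC
import Data.Nat.Properties as ℕP
open import Data.Nat.Tactic.RingSolver using (solve-∀)
open import Data.Maybe using (Maybe; just; nothing)
open import Data.Product using (_,_)
open import Data.Sign as Sign using (Sign)
open import Data.Sum using (inj₁; inj₂)
open import Function using (_∘_)
open import Relation.Nullary using (yes; no)
open import Relation.Binary.PropositionalEquality as P using (_≡_)

-- Every commutative ring receives the canonical homomorphism  ℤ → R,  i ↦ i·1.
-- Instantiating the standard-library ring solver with integer coefficients along
-- it gives a normaliser for polynomial identities (including subtraction) in R.
module IntegerRingSolver {c ℓ} (R : CommutativeRing c ℓ) where
  open CommutativeRing R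
  open import Relation.Binary.Reasoning.Setoid setoid
  open import Algebra.Properties.Ring ring using (-‿involutive; -‿+-comm; -0#≈0#; -1*x≈-x)
  open import Algebra.Properties.CommutativeSemigroup *-commutativeSemigroup using (interchange)
  open import Algebra.Properties.Semiring.Mult.TCOptimised semiring using (1+×; ×-homo-+; ×1-homo-*)
    renaming (_×_ to _×ₙ_)

  -- the image n·1 of a natural number (the optimised multiple, so that 1·1 is 1#)
  ⟦_⟧ℕ : ℕ → Carrier
  ⟦ n ⟧ℕ = n ×ₙ 1#

  ⟦_⟧ℤ : ℤ → Carrier
  ⟦ + n ⟧ℤ    = ⟦ n ⟧ℕ
  ⟦ -[1+ n ] ⟧ℤ = - ⟦ suc n ⟧ℕ

  difference-shift : ∀ a x y → (a + x) - (a + y) ≈ x - y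
  difference-shift a x y = begin
    (a + x) - (a + y)       ≈⟨ +-congˡ (-‿+-comm a y) ⟨
    (a + x) + (- a + - y)   ≈⟨ +-interchange a x (- a) (- y) ⟩
    (a - a) + (x - y)       ≈⟨ +-congʳ (-‿inverseʳ a) ⟩
    0# + (x - y)            ≈⟨ +-identityˡ _ ⟩
    x - y                   ∎
    where open import Algebra.Properties.CommutativeSemigroup +-commutativeSemigroup
            renaming (interchange to +-interchange)

  ⟦⊖⟧ : ∀ m n → ⟦ m ℤ.⊖ n ⟧ℤ ≈ ⟦ m ⟧ℕ - ⟦ n ⟧ℕ
  ⟦⊖⟧ m zero = begin
    ⟦ m ℤ.⊖ 0 ⟧ℤ    ≡⟨ P.cong ⟦_⟧ℤ (ℤP.⊖-≥ {m} {0} ℕ.z≤n) ⟩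
    ⟦ m ⟧ℕ          ≈⟨ +-identityʳ _ ⟨
    ⟦ m ⟧ℕ + 0#     ≈⟨ +-congˡ -0#≈0# ⟨
    ⟦ m ⟧ℕ - 0#     ∎
  ⟦⊖⟧ zero (suc n) = begin
    ⟦ 0 ℤ.⊖ suc n ⟧ℤ  ≡⟨ P.cong ⟦_⟧ℤ (ℤP.⊖-≤ {0} {suc n} ℕ.z≤n) ⟩
    - ⟦ suc n ⟧ℕ      ≈⟨ +-identityˡ _ ⟨
    0# - ⟦ suc n ⟧ℕ   ∎
  ⟦⊖⟧ (suc m) (suc n) = begin
    ⟦ suc m ℤ.⊖ suc n ⟧ℤ          ≡⟨ P.cong ⟦_⟧ℤ (ℤP.[1+m]⊖[1+n]≡m⊖n m n) ⟩
    ⟦ m ℤ.⊖ n ⟧ℤ                  ≈⟨ ⟦⊖⟧ m n ⟩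
    ⟦ m ⟧ℕ - ⟦ n ⟧ℕ               ≈⟨ difference-shift 1# ⟦ m ⟧ℕ ⟦ n ⟧ℕ ⟨
    (1# + ⟦ m ⟧ℕ) - (1# + ⟦ n ⟧ℕ) ≈⟨ +-cong (1+× m 1#) (-‿cong (1+× n 1#)) ⟨
    ⟦ suc m ⟧ℕ - ⟦ suc n ⟧ℕ       ∎

  ⟦+⟧ : ∀ i j → ⟦ i ℤ.+ j ⟧ℤ ≈ ⟦ i ⟧ℤ + ⟦ j ⟧ℤ
  ⟦+⟧ -[1+ m ] -[1+ n ] = begin
    - ⟦ suc (suc (m ℕ.+ n)) ⟧ℕ       ≡⟨ P.cong (λ t → - ⟦ suc t ⟧ℕ) (ℕP.+-suc m n) ⟨
    - ⟦ suc m ℕ.+ suc n ⟧ℕ           ≈⟨ -‿cong (×-homo-+ 1# (suc m) (suc n)) ⟩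
    - (⟦ suc m ⟧ℕ + ⟦ suc n ⟧ℕ)      ≈⟨ -‿+-comm _ _ ⟨
    - ⟦ suc m ⟧ℕ + - ⟦ suc n ⟧ℕ      ∎
  ⟦+⟧ -[1+ m ] (+ n)    = trans (⟦⊖⟧ n (suc m)) (+-comm _ _)
  ⟦+⟧ (+ m)    -[1+ n ] = ⟦⊖⟧ m (suc n)
  ⟦+⟧ (+ m)    (+ n)    = ×-homo-+ 1# m n

  ⟦-⟧ : ∀ i → ⟦ ℤ.- i ⟧ℤ ≈ - ⟦ i ⟧ℤ
  ⟦-⟧ -[1+ n ]  = sym (-‿involutive _)
  ⟦-⟧ (+ zero)  = sym -0#≈0#
  ⟦-⟧ (+ suc n) = refl

  ⟦_⟧± : Sign → Carrier
  ⟦ Sign.+ ⟧± = 1#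
  ⟦ Sign.- ⟧± = - 1#

  ⟦*⟧± : ∀ s t → ⟦ s Sign.* t ⟧± ≈ ⟦ s ⟧± * ⟦ t ⟧±
  ⟦*⟧± Sign.+ t      = sym (*-identityˡ _)
  ⟦*⟧± Sign.- Sign.+ = sym (*-identityʳ _)
  ⟦*⟧± Sign.- Sign.- = sym (trans (-1*x≈-x (- 1#)) (-‿involutive 1#))

  ⟦◃⟧ : ∀ s n → ⟦ s ℤ.◃ n ⟧ℤ ≈ ⟦ s ⟧± * ⟦ n ⟧ℕ
  ⟦◃⟧ s      zero    = sym (zeroʳ _)
  ⟦◃⟧ Sign.+ (suc n) = sym (*-identityˡ _)
  ⟦◃⟧ Sign.- (suc n) = sym (-1*x≈-x _)

  ⟦sign*abs⟧ : ∀ i → ⟦ i ⟧ℤ ≈ ⟦ ℤ.sign i ⟧± * ⟦ ℤ.∣ i ∣ ⟧ℕ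
  ⟦sign*abs⟧ i = trans (reflexive (P.cong ⟦_⟧ℤ (P.sym (ℤP.◃-inverse i)))) (⟦◃⟧ (ℤ.sign i) ℤ.∣ i ∣)

  ⟦*⟧ : ∀ i j → ⟦ i ℤ.* j ⟧ℤ ≈ ⟦ i ⟧ℤ * ⟦ j ⟧ℤ
  ⟦*⟧ i j = begin
    ⟦ i ℤ.* j ⟧ℤ                                       ≈⟨ ⟦◃⟧ (ℤ.sign i Sign.* ℤ.sign j) (ℤ.∣ i ∣ ℕ.* ℤ.∣ j ∣) ⟩
    ⟦ ℤ.sign i Sign.* ℤ.sign j ⟧± * ⟦ ℤ.∣ i ∣ ℕ.* ℤ.∣ j ∣ ⟧ℕ
                                                       ≈⟨ *-cong (⟦*⟧± (ℤ.sign i) (ℤ.sign j)) (×1-homo-* ℤ.∣ i ∣ ℤ.∣ j ∣) ⟩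
    (⟦ ℤ.sign i ⟧± * ⟦ ℤ.sign j ⟧±) * (⟦ ℤ.∣ i ∣ ⟧ℕ * ⟦ ℤ.∣ j ∣ ⟧ℕ)
                                                       ≈⟨ interchange _ _ _ _ ⟩
    (⟦ ℤ.sign i ⟧± * ⟦ ℤ.∣ i ∣ ⟧ℕ) * (⟦ ℤ.sign j ⟧± * ⟦ ℤ.∣ j ∣ ⟧ℕ)
                                                       ≈⟨ *-cong (⟦sign*abs⟧ i) (⟦sign*abs⟧ j) ⟨
    ⟦ i ⟧ℤ * ⟦ j ⟧ℤ                                    ∎

  ℤ⟶R : ℤ.+-*-rawRing -Raw-AlmostCommutative⟶ fromCommutativeRing R
  ℤ⟶R = record
    { ⟦_⟧ = ⟦_⟧ℤ ; +-homo = ⟦+⟧ ; *-homo = ⟦*⟧ ; -‿homo = ⟦-⟧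
    ; 0-homo = refl ; 1-homo = refl }

  ⟦≟⟧ : ∀ i j → Maybe (⟦ i ⟧ℤ ≈ ⟦ j ⟧ℤ)
  ⟦≟⟧ i j with i ℤ.≟ j
  ... | yes P.refl = just refl
  ... | no _       = nothing

  open import Algebra.Solver.Ring ℤ.+-*-rawRing (fromCommutativeRing R) ℤ⟶R ⟦≟⟧ public

C2-suc : ∀ a → suc a C 2 ≡ a +ℕ a C 2
C2-suc a = P.trans (P.sym (ℕC.nCk+nC[k+1]≡[n+1]C[k+1] a 1)) (P.cong (_+ℕ a C 2) (ℕC.nC1≡n a))

-- The exponent  C(n+1-k, 2)  of q in the q-binomial theorem gains n+1 when n grows
-- by one, up to the factor q^k supplied by the q-Pascal rule.
binomial-exponent-step : ∀ n k → k ≤ n →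
  k +ℕ (suc (suc n) ∸ k) C 2 ≡ (suc n ∸ k) C 2 +ℕ suc n
binomial-exponent-step n k k≤n = begin
  k +ℕ (suc (suc n) ∸ k) C 2  ≡⟨ P.cong (λ t → k +ℕ t C 2) (ℕP.+-∸-assoc 1 k≤1+n) ⟩
  k +ℕ suc a C 2              ≡⟨ P.cong (k +ℕ_) (C2-suc a) ⟩
  k +ℕ (a +ℕ a C 2)           ≡⟨ rearrange k a (a C 2) ⟩
  a C 2 +ℕ (a +ℕ k)           ≡⟨ P.cong (a C 2 +ℕ_) (ℕP.m∸n+n≡m k≤1+n) ⟩
  a C 2 +ℕ suc n              ∎
  where
  open P.≡-Reasoning
  a = suc n ∸ k
  k≤1+n = ℕP.m≤n⇒m≤1+n k≤n
  rearrange : ∀ k a x → k +ℕ (a +ℕ x) ≡ x +ℕ (a +ℕ k)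
  rearrange = solve-∀

raising-exponent-step : ∀ k → 2 *ℕ (suc k C 2) ≡ 2 *ℕ (k C 2) +ℕ k +ℕ k
raising-exponent-step k = P.trans (P.cong (2 *ℕ_) (C2-suc k)) (double k (k C 2))
  where
  double : ∀ k x → 2 *ℕ (k +ℕ x) ≡ 2 *ℕ x +ℕ k +ℕ k
  double = solve-∀

module FieldTheory {ℓ₁ ℓ₂ : Level} (F : Field ℓ₁ ℓ₂) where
  open Field F hiding (zero)
  open IntegerRingSolver commutativeRing
  open import Relation.Binary.Reasoning.Setoid setoid
  open import Algebra.Properties.CommutativeSemigroup *-commutativeSemigroup using (interchange)
  open import Algebra.Properties.Semiring.Exp semiring using (_^_; ^-homo-*; ^-assocʳ)
  open import Algebra.Properties.CommutativeSemiring.Exp commutativeSemiring using (^-distrib-*)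
  open import Algebra.Properties.Ring ring using (-‿involutive; -0#≈0#)

  vanishingʳ : ∀ x {y} → y ≈ 0# → x * y ≈ 0#
  vanishingʳ x y≈0 = trans (*-congˡ y≈0) (zeroʳ x)

  vanishingˡ : ∀ {x} y → x ≈ 0# → x * y ≈ 0#
  vanishingˡ y x≈0 = trans (*-congʳ x≈0) (zeroˡ y)

  trivial : 1# ≈ 0# → ∀ x → x ≈ 0#
  trivial 1≈0 x = trans (sym (*-identityʳ x)) (vanishingʳ x 1≈0)

  ⁻¹-inverseˡ : ∀ x → ¬ (x ≈ 0#) → x ⁻¹ * x ≈ 1#
  ⁻¹-inverseˡ x x≉0 = trans (*-comm _ _) (⁻¹-inverse x x≉0)

  nonzero-* : ∀ {x y} → ¬ (x ≈ 0#) → ¬ (y ≈ 0#) → ¬ (x * y ≈ 0#)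
  nonzero-* {x} {y} x≉0 y≉0 xy≈0 = x≉0 (begin
    x                ≈⟨ *-identityʳ x ⟨
    x * 1#           ≈⟨ *-congˡ (⁻¹-inverse y y≉0) ⟨
    x * (y * y ⁻¹)   ≈⟨ *-assoc x y (y ⁻¹) ⟨
    (x * y) * y ⁻¹   ≈⟨ *-congʳ xy≈0 ⟩
    0# * y ⁻¹        ≈⟨ zeroˡ _ ⟩
    0#               ∎)

  solve-for : ∀ {u x y} → ¬ (u ≈ 0#) → u * x ≈ y → x ≈ u ⁻¹ * y
  solve-for {u} {x} {y} u≉0 ux≈y = begin
    x                ≈⟨ *-identityˡ x ⟨
    1# * x           ≈⟨ *-congʳ (⁻¹-inverseˡ u u≉0) ⟨
    (u ⁻¹ * u) * x   ≈⟨ *-assoc _ _ _ ⟩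
    u ⁻¹ * (u * x)   ≈⟨ *-congˡ ux≈y ⟩
    u ⁻¹ * y         ∎

  cancelˡ : ∀ {u x y} → ¬ (u ≈ 0#) → u * x ≈ u * y → x ≈ y
  cancelˡ u≉0 e = trans (solve-for u≉0 e) (sym (solve-for u≉0 refl))

  inverse-unique : ∀ {x y} → ¬ (x ≈ 0#) → x * y ≈ 1# → x ⁻¹ ≈ y
  inverse-unique {x} {y} x≉0 xy≈1 =
    sym (trans (solve-for x≉0 xy≈1) (*-identityʳ _))

  -- the operation ⁻¹ is only known to be a congruence on nonzero elements
  inverse-cong : ∀ {x y} → ¬ (x ≈ 0#) → x ≈ y → x ⁻¹ ≈ y ⁻¹
  inverse-cong {x} {y} x≉0 x≈y = sym (inverse-unique (λ y≈0 → x≉0 (trans x≈y y≈0))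
    (trans (*-congʳ (sym x≈y)) (⁻¹-inverse x x≉0)))

  cross-multiply : ∀ {A B u v} → ¬ (A ≈ 0#) → ¬ (B ≈ 0#) →
                   u * B ≈ v * A → u * A ⁻¹ ≈ v * B ⁻¹
  cross-multiply {A} {B} {u} {v} A≉0 B≉0 uB≈vA = begin
    u * A ⁻¹                        ≈⟨ *-identityʳ _ ⟨
    (u * A ⁻¹) * 1#                 ≈⟨ *-congˡ (⁻¹-inverse B B≉0) ⟨
    (u * A ⁻¹) * (B * B ⁻¹)         ≈⟨ interchange u (A ⁻¹) B (B ⁻¹) ⟩
    (u * B) * (A ⁻¹ * B ⁻¹)         ≈⟨ *-cong uB≈vA (*-comm _ _) ⟩
    (v * A) * (B ⁻¹ * A ⁻¹)         ≈⟨ interchange v A (B ⁻¹) (A ⁻¹) ⟩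
    (v * B ⁻¹) * (A * A ⁻¹)         ≈⟨ *-congˡ (⁻¹-inverse A A≉0) ⟩
    (v * B ⁻¹) * 1#                 ≈⟨ *-identityʳ _ ⟩
    v * B ⁻¹                        ∎

  inverse-neg : ∀ {c} → ¬ (c ≈ 0#) → (- c) ⁻¹ ≈ - (c ⁻¹)
  inverse-neg {c} c≉0 = inverse-unique -c≉0 (begin
    (- c) * (- (c ⁻¹)) ≈⟨ solve 2 (λ c c' → (:- c) :* (:- c') := c :* c') refl c (c ⁻¹) ⟩
    c * c ⁻¹           ≈⟨ ⁻¹-inverse c c≉0 ⟩
    1#                 ∎)
    where
    -c≉0 : ¬ (- c ≈ 0#)
    -c≉0 -c≈0 = c≉0 (begin
      c        ≈⟨ -‿involutive c ⟨
      - (- c)  ≈⟨ -‿cong -c≈0 ⟩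
      - 0#     ≈⟨ -0#≈0# ⟩
      0#       ∎)

  -- The powers  pow x n  of Defs agree with the library's monoid powers,
  -- so the exponent laws can be imported.
  pow≡^ : ∀ x n → pow F x n ≡ x ^ n
  pow≡^ x zero    = P.refl
  pow≡^ x (suc n) = P.cong (x *_) (pow≡^ x n)

  pow-+ : ∀ x m n → pow F x (m +ℕ n) ≈ pow F x m * pow F x n
  pow-+ x m n rewrite pow≡^ x (m +ℕ n) | pow≡^ x m | pow≡^ x n = ^-homo-* x m n

  pow-distrib : ∀ x y n → pow F (x * y) n ≈ pow F x n * pow F y n
  pow-distrib x y n rewrite pow≡^ (x * y) n | pow≡^ x n | pow≡^ y n = ^-distrib-* x y n

  pow-swap : ∀ x m n → pow F (pow F x m) n ≈ pow F (pow F x n) m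
  pow-swap x m n rewrite pow≡^ (pow F x m) n | pow≡^ (pow F x n) m | pow≡^ x m | pow≡^ x n =
    trans (^-assocʳ x m n) (trans (reflexive (P.cong (x ^_) (ℕP.*-comm m n))) (sym (^-assocʳ x n m)))

  pow-inverse : ∀ {x y} n → x * y ≈ 1# → pow F x n * pow F y n ≈ 1#
  pow-inverse zero    xy≈1 = *-identityʳ 1#
  pow-inverse {x} {y} (suc n) xy≈1 = begin
    (x * pow F x n) * (y * pow F y n)   ≈⟨ interchange _ _ _ _ ⟩
    (x * y) * (pow F x n * pow F y n)   ≈⟨ *-cong xy≈1 (pow-inverse n xy≈1) ⟩
    1# * 1#                             ≈⟨ *-identityʳ 1# ⟩
    1#                                  ∎

  ∑ : ℕ → (ℕ → Carrier) → Carrier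
  ∑ zero    g = g zero
  ∑ (suc n) g = ∑ n g + g (suc n)

  sumₛ-coefficient : ∀ n (f : ℕ → Series F) m l → sumₛ F n f m l ≈ ∑ n (λ k → f k m l)
  sumₛ-coefficient zero    f m l = refl
  sumₛ-coefficient (suc n) f m l = +-congʳ (sumₛ-coefficient n f m l)

  ∑-cong : ∀ n {g h : ℕ → Carrier} → (∀ k → k ≤ n → g k ≈ h k) → ∑ n g ≈ ∑ n h
  ∑-cong zero    g≈h = g≈h zero ℕ.z≤n
  ∑-cong (suc n) g≈h = +-cong (∑-cong n (λ k k≤n → g≈h k (ℕP.m≤n⇒m≤1+n k≤n))) (g≈h (suc n) ℕP.≤-refl)

  ∑-+ : ∀ n (g h : ℕ → Carrier) → ∑ n (λ k → g k + h k) ≈ ∑ n g + ∑ n h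
  ∑-+ zero    g h = refl
  ∑-+ (suc n) g h = trans (+-congʳ (∑-+ n g h)) (+-interchange _ _ _ _)
    where open import Algebra.Properties.CommutativeSemigroup +-commutativeSemigroup
            renaming (interchange to +-interchange)

  ∑-*ʳ : ∀ n (g : ℕ → Carrier) x → ∑ n g * x ≈ ∑ n (λ k → g k * x)
  ∑-*ʳ zero    g x = refl
  ∑-*ʳ (suc n) g x = trans (distribʳ _ _ _) (+-congʳ (∑-*ʳ n g x))

  ∑-first : ∀ n (g : ℕ → Carrier) → ∑ (suc n) g ≈ g zero + ∑ n (λ k → g (suc k))
  ∑-first zero    g = refl
  ∑-first (suc n) g = trans (+-congʳ (∑-first n g)) (+-assoc _ _ _)

  ∏ : ℕ → (ℕ → Carrier) → Carrier
  ∏ zero    f = 1#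
  ∏ (suc n) f = ∏ n f * f n

  ∏-cong : ∀ n {f g : ℕ → Carrier} → (∀ k → f k ≈ g k) → ∏ n f ≈ ∏ n g
  ∏-cong zero    f≈g = refl
  ∏-cong (suc n) f≈g = *-cong (∏-cong n f≈g) (f≈g n)

  ∏-* : ∀ n (f g : ℕ → Carrier) → ∏ n f * ∏ n g ≈ ∏ n (λ k → f k * g k)
  ∏-* zero    f g = *-identityˡ _
  ∏-* (suc n) f g = trans (interchange _ _ _ _) (*-congʳ (∏-* n f g))

  ∏-first : ∀ n (f : ℕ → Carrier) → ∏ (suc n) f ≈ f zero * ∏ n (λ k → f (suc k))
  ∏-first zero    f = trans (*-identityˡ _) (sym (*-identityʳ _))
  ∏-first (suc n) f = trans (*-congʳ (∏-first n f)) (*-assoc _ _ _)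

  -- Calculus of the q-Pochhammer symbol and of the q-binomial coefficients for a fixed base q.
  module QCalculus (q : Carrier) where

    q^_ : ℕ → Carrier
    q^ n = pow F q n

    ⟨_⟩_ : Carrier → ℕ → Carrier
    ⟨ z ⟩ N = poch F z q N

    infix 9 q^_ ⟨_⟩_

    poch-cong : ∀ {z z'} N → z ≈ z' → ⟨ z ⟩ N ≈ ⟨ z' ⟩ N
    poch-cong zero    z≈z' = refl
    poch-cong (suc N) z≈z' = *-cong (poch-cong N z≈z') (+-congˡ (-‿cong (*-congʳ z≈z')))

    poch-∏ : ∀ z N → ⟨ z ⟩ N ≈ ∏ N (λ j → 1# - z * q^ j)
    poch-∏ z zero    = refl
    poch-∏ z (suc N) = *-congʳ (poch-∏ z N)

    poch-first : ∀ d N → ⟨ d ⟩ suc N ≈ (1# - d) * ⟨ d * q ⟩ N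
    poch-first d zero    = trans (*-identityˡ _) (trans (+-congˡ (-‿cong (*-identityʳ d))) (sym (*-identityʳ _)))
    poch-first d (suc N) = begin
      ⟨ d ⟩ suc N * (1# - d * (q * q^ N))             ≈⟨ *-congʳ (poch-first d N) ⟩
      ((1# - d) * ⟨ d * q ⟩ N) * (1# - d * (q * q^ N)) ≈⟨ *-assoc _ _ _ ⟩
      (1# - d) * (⟨ d * q ⟩ N * (1# - d * (q * q^ N))) ≈⟨ *-congˡ (*-congˡ (+-congˡ (-‿cong (*-assoc _ _ _)))) ⟨
      (1# - d) * ⟨ d * q ⟩ suc N                       ∎

    poch-split : ∀ d j N → ⟨ d ⟩ (j +ℕ N) ≈ ⟨ d ⟩ j * ⟨ d * q^ j ⟩ N
    poch-split d zero    N = sym (trans (*-identityˡ _) (poch-cong N (*-identityʳ d)))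
    poch-split d (suc j) N = begin
      ⟨ d ⟩ suc (j +ℕ N)                                 ≈⟨ poch-first d (j +ℕ N) ⟩
      (1# - d) * ⟨ d * q ⟩ (j +ℕ N)                      ≈⟨ *-congˡ (poch-split (d * q) j N) ⟩
      (1# - d) * (⟨ d * q ⟩ j * ⟨ d * q * q^ j ⟩ N)      ≈⟨ *-assoc _ _ _ ⟨
      ((1# - d) * ⟨ d * q ⟩ j) * ⟨ d * q * q^ j ⟩ N      ≈⟨ *-cong (poch-first d j) (poch-cong N (sym (*-assoc _ _ _))) ⟨
      ⟨ d ⟩ suc j * ⟨ d * q^ suc j ⟩ N                   ∎

    -- d is admissible as a lower parameter: no (d; q)_N vanishes
    Regular : Carrier → Set ℓ₂
    Regular d = ∀ N → ¬ (⟨ d ⟩ N ≈ 0#)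

    regular-q : ∀ {d} → Regular d → Regular (d * q)
    regular-q {d} reg N e = reg (suc N) (trans (poch-first d N) (vanishingʳ _ e))

    regular-shift : ∀ {d} j → Regular d → Regular (d * q^ j)
    regular-shift {d} j reg N e = reg (j +ℕ N) (trans (poch-split d j N) (vanishingʳ _ e))

    gauss : ℕ → ℕ → Carrier
    gauss n       zero    = 1#
    gauss zero    (suc k) = 0#
    gauss (suc n) (suc k) = gauss n k + q^ suc k * gauss n (suc k)

    gauss-above : ∀ n k → n ℕ.< k → gauss n k ≈ 0#
    gauss-above zero    (suc k) _         = refl
    gauss-above (suc n) (suc k) (ℕ.s≤s n<k) = begin
      gauss n k + q^ suc k * gauss n (suc k)   ≈⟨ +-cong (gauss-above n k n<k)
                                                   (vanishingʳ _ (gauss-above n (suc k) (ℕP.m≤n⇒m≤1+n n<k))) ⟩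
      0# + 0#                                  ≈⟨ +-identityʳ 0# ⟩
      0#                                       ∎

    gauss-factorial : ∀ n k → k ≤ n → gauss n k * (⟨ q ⟩ k * ⟨ q ⟩ (n ∸ k)) ≈ ⟨ q ⟩ n
    gauss-factorial n       zero    _           = trans (*-identityˡ _) (*-identityˡ _)
    gauss-factorial (suc n) (suc k) (ℕ.s≤s k≤n) = begin
      (X + u * Y) * ((A * (1# - u)) * B)
        ≈⟨ solve 5 (λ X Y A B u → (X :+ u :* Y) :* ((A :* (con (+ 1) :- u)) :* B)
                   := X :* (A :* B) :* (con (+ 1) :- u) :+ u :* (Y :* ((A :* (con (+ 1) :- u)) :* B)))
                   refl X Y A B u ⟩
      X * (A * B) * (1# - u) + u * (Y * (⟨ q ⟩ suc k * B))
        ≈⟨ +-cong (*-congʳ (gauss-factorial n k k≤n)) (*-congˡ upper-term) ⟩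
      ⟨ q ⟩ n * (1# - u) + u * (⟨ q ⟩ n * (1# - q^ (n ∸ k)))
        ≈⟨ solve 3 (λ P u v → P :* (con (+ 1) :- u) :+ u :* (P :* (con (+ 1) :- v))
                   := P :* (con (+ 1) :- u :* v)) refl (⟨ q ⟩ n) u (q^ (n ∸ k)) ⟩
      ⟨ q ⟩ n * (1# - u * q^ (n ∸ k))
        ≈⟨ *-congˡ (+-congˡ (-‿cong exponents)) ⟩
      ⟨ q ⟩ suc n ∎
      where
      X = gauss n k
      Y = gauss n (suc k)
      A = ⟨ q ⟩ k
      B = ⟨ q ⟩ (n ∸ k)
      u = q^ suc k
      exponents : u * q^ (n ∸ k) ≈ q * q^ n
      exponents = trans (sym (pow-+ q (suc k) (n ∸ k)))
                        (reflexive (P.cong (q^_ ∘ suc) (ℕP.m+[n∸m]≡n k≤n)))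
      -- the second Pascal summand; it vanishes when k = n
      upper-term : Y * (⟨ q ⟩ suc k * B) ≈ ⟨ q ⟩ n * (1# - q^ (n ∸ k))
      upper-term with ℕP.m≤n⇒m<n∨m≡n k≤n
      ... | inj₂ P.refl rewrite ℕP.n∸n≡0 k = begin
        Y * (⟨ q ⟩ suc k * 1#)   ≈⟨ vanishingˡ _ (gauss-above k (suc k) ℕP.≤-refl) ⟩
        0#                       ≈⟨ vanishingʳ _ (-‿inverseʳ 1#) ⟨
        ⟨ q ⟩ k * (1# - 1#)      ∎
      ... | inj₁ k<n rewrite ℕP.+-∸-assoc 1 k<n = begin
        Y * (⟨ q ⟩ suc k * (B' * v))   ≈⟨ solve 4 (λ Y A B v → Y :* (A :* (B :* v)) := Y :* (A :* B) :* v)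
                                              refl Y (⟨ q ⟩ suc k) B' v ⟩
        Y * (⟨ q ⟩ suc k * B') * v     ≈⟨ *-congʳ (gauss-factorial n (suc k) k<n) ⟩
        ⟨ q ⟩ n * v                    ∎
        where
        B' = ⟨ q ⟩ (n ∸ suc k)
        v = 1# - q * q^ (n ∸ suc k)

    q-factorial-nonzero : (∀ j → ¬ (⟨ q ⟩ suc j ≈ 0#)) → ∀ k → ¬ (⟨ q ⟩ k ≈ 0#)
    q-factorial-nonzero nz zero    1≈0 = nz 0 (trivial 1≈0 _)
    q-factorial-nonzero nz (suc k)     = nz k

    qbinom≈gauss : (∀ j → ¬ (⟨ q ⟩ suc j ≈ 0#)) → ∀ n k → k ≤ n → qbinom F q n k ≈ gauss n k
    qbinom≈gauss nz n k k≤n = trans (*-comm _ _) (sym (solve-for denominator≉0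
                                    (trans (*-comm _ _) (gauss-factorial n k k≤n))))
      where
      denominator≉0 = nonzero-* (q-factorial-nonzero nz k) (q-factorial-nonzero nz (n ∸ k))

    -- [n, k-1], with [n, -1] = 0
    gauss↓ : ℕ → ℕ → Carrier
    gauss↓ n zero    = 0#
    gauss↓ n (suc k) = gauss n k

    gauss-pascal : ∀ n k → gauss (suc n) k ≈ gauss↓ n k + q^ k * gauss n k
    gauss-pascal n zero    = sym (trans (+-identityˡ _) (*-identityˡ _))
    gauss-pascal n (suc k) = refl

    -- This is the induction step of both the q-binomial theorem and the raising expansion.
    pascal-sum : ∀ n (R : ℕ → Carrier) →
      ∑ (suc n) (λ k → gauss (suc n) k * R k) ≈ ∑ n (λ k → gauss n k * (R (suc k) + q^ k * R k))
    pascal-sum n R = begin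
      ∑ (suc n) (λ k → gauss (suc n) k * R k)
        ≈⟨ ∑-cong (suc n) (λ k _ → pascal-term k) ⟩
      ∑ (suc n) (λ k → gauss↓ n k * R k + gauss n k * (q^ k * R k))
        ≈⟨ ∑-+ (suc n) _ _ ⟩
      ∑ (suc n) (λ k → gauss↓ n k * R k)
        + (∑ n (λ k → gauss n k * (q^ k * R k)) + gauss n (suc n) * (q^ suc n * R (suc n)))
        ≈⟨ +-cong (∑-first n _) (+-congˡ (vanishingˡ _ (gauss-above n (suc n) ℕP.≤-refl))) ⟩
      (0# * R 0 + ∑ n (λ k → gauss n k * R (suc k))) + (∑ n (λ k → gauss n k * (q^ k * R k)) + 0#)
        ≈⟨ +-cong (trans (+-congʳ (zeroˡ _)) (+-identityˡ _)) (+-identityʳ _) ⟩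
      ∑ n (λ k → gauss n k * R (suc k)) + ∑ n (λ k → gauss n k * (q^ k * R k))
        ≈⟨ ∑-+ n _ _ ⟨
      ∑ n (λ k → gauss n k * R (suc k) + gauss n k * (q^ k * R k))
        ≈⟨ ∑-cong n (λ k _ → sym (distribˡ _ _ _)) ⟩
      ∑ n (λ k → gauss n k * (R (suc k) + q^ k * R k)) ∎
      where
      split : ∀ a b x r → (a + x * b) * r ≈ a * r + b * (x * r)
      split = solve 4 (λ a b x r → (a :+ x :* b) :* r := a :* r :+ b :* (x :* r)) refl
      pascal-term : ∀ k → gauss (suc n) k * R k ≈ gauss↓ n k * R k + gauss n k * (q^ k * R k)
      pascal-term k = trans (*-congʳ (gauss-pascal n k)) (split (gauss↓ n k) (gauss n k) (q^ k) (R k))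

    binomial-term : Carrier → Carrier → ℕ → ℕ → Carrier
    binomial-term x y n k = pow F x (n ∸ k) * q^ ((suc n ∸ k) C 2) * pow F y k

    binomial-term-step : ∀ x y n k → k ≤ n →
      binomial-term x y n k * (y + x * q^ suc n) ≈
      binomial-term x y (suc n) (suc k) + q^ k * binomial-term x y (suc n) k
    binomial-term-step x y n k k≤n = begin
      E * Q * Y * (y + x * Qs)                 ≈⟨ solve 6 (λ E Q Y y x Qs → E :* Q :* Y :* (y :+ x :* Qs)
                                                          := E :* Q :* (y :* Y) :+ (x :* E) :* (Q :* Qs) :* Y)
                                                     refl E Q Y y x Qs ⟩
      E * Q * (y * Y) + (x * E) * (Q * Qs) * Y ≈⟨ +-congˡ (*-congʳ (*-cong (sym x-power) (sym q-power))) ⟩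
      E * Q * (y * Y) + E' * (q^ k * Q') * Y   ≈⟨ +-congˡ (solve 4 (λ E' a Q' Y → E' :* (a :* Q') :* Y := a :* (E' :* Q' :* Y))
                                                                refl E' (q^ k) Q' Y) ⟩
      E * Q * (y * Y) + q^ k * (E' * Q' * Y)   ∎
      where
      E = pow F x (n ∸ k)
      E' = pow F x (suc n ∸ k)
      Q = q^ ((suc n ∸ k) C 2)
      Q' = q^ ((suc (suc n) ∸ k) C 2)
      Qs = q^ suc n
      Y = pow F y k
      x-power : E' ≈ x * E
      x-power = reflexive (P.cong (pow F x) (ℕP.+-∸-assoc 1 k≤n))
      q-power : q^ k * Q' ≈ Q * Qs
      q-power = trans (sym (pow-+ q k _)) (trans (reflexive (P.cong q^_ (binomial-exponent-step n k k≤n)))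
                                                  (pow-+ q ((suc n ∸ k) C 2) (suc n)))

    q-binomial-theorem : ∀ x y n →
      ∏ n (λ j → y + x * q^ suc j) ≈ ∑ n (λ k → gauss n k * binomial-term x y n k)
    q-binomial-theorem x y zero    = sym (trans (*-identityˡ _) (trans (*-identityʳ _) (*-identityˡ _)))
    q-binomial-theorem x y (suc n) = begin
      ∏ n f * f n                                                 ≈⟨ *-congʳ (q-binomial-theorem x y n) ⟩
      ∑ n (λ k → gauss n k * T n k) * f n                         ≈⟨ ∑-*ʳ n _ _ ⟩
      ∑ n (λ k → gauss n k * T n k * f n)                         ≈⟨ ∑-cong n (λ k k≤n → trans (*-assoc _ _ _)
                                                                       (*-congˡ (binomial-term-step x y n k k≤n))) ⟩
      ∑ n (λ k → gauss n k * (T (suc n) (suc k) + q^ k * T (suc n) k)) ≈⟨ pascal-sum n (T (suc n)) ⟨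
      ∑ (suc n) (λ k → gauss (suc n) k * T (suc n) k)             ∎
      where
      f : ℕ → Carrier
      f j = y + x * q^ suc j
      T = binomial-term x y

    raising-weight : ℕ → Carrier → ℕ → Carrier
    raising-weight n c k = pow F c k * q^ (2 *ℕ (k C 2)) * ⟨ c * q^ k ⟩ (n ∸ k)

    -- Induction on n, applied to the shifted sequence G_{j+1} with parameter cq.
    raising-expansion : ∀ Z n (G : ℕ → Carrier) c →
      (∀ j → G (suc j) * (1# - c * q^ j * Z) ≈ (1# - c * q^ j) * G j) →
      G n ≈ ∑ n (λ k → gauss n k * (raising-weight n c k * (pow F Z k * G k)))
    raising-expansion Z zero    G c rec =
      solve 1 (λ g → g := con (+ 1) :* ((con (+ 1) :* con (+ 1) :* con (+ 1)) :* (con (+ 1) :* g))) refl (G 0)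
    raising-expansion Z (suc n) G c rec = begin
      G (suc n)
        ≈⟨ raising-expansion Z n (G ∘ suc) (c * q) shifted-rec ⟩
      ∑ n (λ k → gauss n k * (raising-weight n (c * q) k * (pow F Z k * G (suc k))))
        ≈⟨ ∑-cong n (λ k k≤n → *-congˡ (weight-step k k≤n)) ⟩
      ∑ n (λ k → gauss n k * (R (suc k) + q^ k * R k))
        ≈⟨ pascal-sum n R ⟨
      ∑ (suc n) (λ k → gauss (suc n) k * R k) ∎
      where
      R : ℕ → Carrier
      R k = raising-weight (suc n) c k * (pow F Z k * G k)

      reassoc : ∀ j → c * q * q^ j ≈ c * q^ suc j
      reassoc j = *-assoc c q (q^ j)

      shifted-rec : ∀ j → G (suc (suc j)) * (1# - c * q * q^ j * Z) ≈ (1# - c * q * q^ j) * G (suc j)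
      shifted-rec j = begin
        G (suc (suc j)) * (1# - c * q * q^ j * Z)   ≈⟨ *-congˡ (+-congˡ (-‿cong (*-congʳ (reassoc j)))) ⟩
        G (suc (suc j)) * (1# - c * q^ suc j * Z)   ≈⟨ rec (suc j) ⟩
        (1# - c * q^ suc j) * G (suc j)             ≈⟨ *-congʳ (+-congˡ (-‿cong (reassoc j))) ⟨
        (1# - c * q * q^ j) * G (suc j)             ∎

      unfolded : ∀ k → G (suc k) ≈ (1# - c * q^ k) * G k + c * q^ k * Z * G (suc k)
      unfolded k = begin
        G (suc k)                                              ≈⟨ solve 2 (λ g d → g := g :* (con (+ 1) :- d) :+ d :* g)
                                                                     refl (G (suc k)) (c * q^ k * Z) ⟩
        G (suc k) * (1# - c * q^ k * Z) + c * q^ k * Z * G (suc k) ≈⟨ +-congʳ (rec k) ⟩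
        (1# - c * q^ k) * G k + c * q^ k * Z * G (suc k)         ∎

      weight-step : ∀ k → k ≤ n →
        raising-weight n (c * q) k * (pow F Z k * G (suc k)) ≈ R (suc k) + q^ k * R k
      weight-step k k≤n = begin
        pow F (c * q) k * QE * ⟨ c * q * qk ⟩ (n ∸ k) * (Zk * Gs)
          ≈⟨ *-cong (*-cong (*-congʳ (pow-distrib c q k)) (poch-cong (n ∸ k) (*-assoc c q qk)))
                    (*-congˡ (unfolded k)) ⟩
        (ck * qk) * QE * Pk * (Zk * ((1# - c * qk) * Gk + c * qk * Z * Gs))
          ≈⟨ solve 10 (λ ck qk QE Pk Zk Gk Gs c Z u →
                 (ck :* qk) :* QE :* Pk :* (Zk :* (u :* Gk :+ c :* qk :* Z :* Gs))
              := (c :* ck) :* (QE :* qk :* qk) :* Pk :* ((Z :* Zk) :* Gs) :+ qk :* (ck :* QE :* (u :* Pk) :* (Zk :* Gk)))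
              refl ck qk QE Pk Zk Gk Gs c Z (1# - c * qk) ⟩
        (c * ck) * (QE * qk * qk) * Pk * ((Z * Zk) * Gs) + qk * (ck * QE * ((1# - c * qk) * Pk) * (Zk * Gk))
          ≈⟨ +-cong (*-congʳ (*-congʳ (*-congˡ (sym exponent))))
                    (*-congˡ (*-congʳ (*-congˡ (sym first-factor)))) ⟩
        R (suc k) + qk * R k ∎
        where
        ck = pow F c k
        qk = q^ k
        QE = q^ (2 *ℕ (k C 2))
        Pk = ⟨ c * q^ suc k ⟩ (n ∸ k)
        Zk = pow F Z k
        Gk = G k
        Gs = G (suc k)
        exponent : q^ (2 *ℕ (suc k C 2)) ≈ QE * qk * qk
        exponent = trans (reflexive (P.cong q^_ (raising-exponent-step k)))
                         (trans (pow-+ q (2 *ℕ (k C 2) +ℕ k) k) (*-congʳ (pow-+ q (2 *ℕ (k C 2)) k)))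
        first-factor : ⟨ c * qk ⟩ (suc n ∸ k) ≈ (1# - c * qk) * Pk
        first-factor rewrite ℕP.+-∸-assoc 1 k≤n =
          trans (poch-first (c * qk) (n ∸ k))
                (*-congˡ (poch-cong (n ∸ k) (trans (*-assoc c qk q) (*-congˡ (*-comm qk q)))))

    poch-reversed : ∀ {r} → r * q ≈ 1# → ∀ n d →
      ⟨ d * pow F r n ⟩ n ≈ ∏ n (λ j → 1# - d * pow F r (suc j))
    poch-reversed rq zero    d = refl
    poch-reversed {r} rq (suc n) d = begin
      ⟨ d * (r * rn) ⟩ n * (1# - d * (r * rn) * q^ n)  ≈⟨ *-cong (poch-cong n (sym (*-assoc d r rn)))
                                                                  (+-congˡ (-‿cong last-factor)) ⟩
      ⟨ d * r * rn ⟩ n * f 0                          ≈⟨ *-congʳ (poch-reversed rq n (d * r)) ⟩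
      ∏ n (λ j → 1# - d * r * pow F r (suc j)) * f 0  ≈⟨ *-congʳ (∏-cong n (λ j → +-congˡ (-‿cong (*-assoc _ _ _)))) ⟩
      ∏ n (λ j → f (suc j)) * f 0                     ≈⟨ *-comm _ _ ⟩
      f 0 * ∏ n (λ j → f (suc j))                     ≈⟨ ∏-first n f ⟨
      ∏ (suc n) f                                     ∎
      where
      rn = pow F r n
      f : ℕ → Carrier
      f j = 1# - d * pow F r (suc j)
      last-factor : d * (r * rn) * q^ n ≈ d * (r * 1#)
      last-factor = begin
        d * (r * rn) * q^ n     ≈⟨ solve 4 (λ d r x y → d :* (r :* x) :* y := d :* (r :* (x :* y))) refl d r rn (q^ n) ⟩
        d * (r * (rn * q^ n))   ≈⟨ *-congˡ (*-congˡ (pow-inverse n rq)) ⟩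
        d * (r * 1#)            ∎

    -- With r q = 1 and c ≠ 0, for every Z:
    --   (c r^n; q)_n ∏_{j<n} (Z + (-c)⁻¹ q^{j+1}) = (c r^n Z; q)_n (q/c; q)_n,
    -- which follows factor by factor: with s = c c⁻¹ r^{j+1} q^{j+1} = 1,
    --   (1 - c r^{j+1}) (Z - c⁻¹ q^{j+1}) = (1 - c Z r^{j+1}) (1 - q c⁻¹ q^j) + (1 - Z)(s - 1).
    lowering-product : ∀ {r c} → r * q ≈ 1# → ¬ (c ≈ 0#) → ∀ Z n →
      ⟨ c * pow F r n ⟩ n * ∏ n (λ j → Z + (- c) ⁻¹ * q^ suc j) ≈ ⟨ c * pow F r n * Z ⟩ n * ⟨ q * c ⁻¹ ⟩ n
    lowering-product {r} {c} rq c≉0 Z n = begin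
      ⟨ c * pow F r n ⟩ n * ∏ n (λ j → Z + (- c) ⁻¹ * q^ suc j)
        ≈⟨ *-congʳ (poch-reversed rq n c) ⟩
      ∏ n (λ j → 1# - c * pow F r (suc j)) * ∏ n (λ j → Z + (- c) ⁻¹ * q^ suc j)
        ≈⟨ ∏-* n _ _ ⟩
      ∏ n (λ j → (1# - c * pow F r (suc j)) * (Z + (- c) ⁻¹ * q^ suc j))
        ≈⟨ ∏-cong n factor ⟩
      ∏ n (λ j → (1# - c * Z * pow F r (suc j)) * (1# - q * c ⁻¹ * q^ j))
        ≈⟨ ∏-* n _ _ ⟨
      ∏ n (λ j → 1# - c * Z * pow F r (suc j)) * ∏ n (λ j → 1# - q * c ⁻¹ * q^ j)
        ≈⟨ *-cong (poch-reversed rq n (c * Z)) (poch-∏ (q * c ⁻¹) n) ⟨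
      ⟨ c * Z * pow F r n ⟩ n * ⟨ q * c ⁻¹ ⟩ n
        ≈⟨ *-congʳ (poch-cong n (solve 3 (λ c Z x → c :* Z :* x := c :* x :* Z) refl c Z (pow F r n))) ⟩
      ⟨ c * pow F r n * Z ⟩ n * ⟨ q * c ⁻¹ ⟩ n ∎
      where
      c' = c ⁻¹
      factor : ∀ j → (1# - c * pow F r (suc j)) * (Z + (- c) ⁻¹ * q^ suc j) ≈
                     (1# - c * Z * pow F r (suc j)) * (1# - q * c' * q^ j)
      factor j = begin
        (1# - c * R) * (Z + (- c) ⁻¹ * (q * Q))
          ≈⟨ *-congˡ (+-congˡ (*-congʳ (inverse-neg c≉0))) ⟩
        (1# - c * R) * (Z + (- c') * (q * Q))
          ≈⟨ solve 6 (λ c c' R Z q Q →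
                 (con (+ 1) :- c :* R) :* (Z :+ (:- c') :* (q :* Q))
              := (con (+ 1) :- c :* Z :* R) :* (con (+ 1) :- q :* c' :* Q)
                   :+ (con (+ 1) :- Z) :* ((c :* c') :* (R :* (q :* Q)) :- con (+ 1)))
              refl c c' R Z q Q ⟩
        (1# - c * Z * R) * (1# - q * c' * Q) + (1# - Z) * (s - 1#)
          ≈⟨ +-congˡ (vanishingʳ _ (trans (+-congʳ s≈1) (-‿inverseʳ 1#))) ⟩
        (1# - c * Z * R) * (1# - q * c' * Q) + 0#
          ≈⟨ +-identityʳ _ ⟩
        (1# - c * Z * R) * (1# - q * c' * Q) ∎
        where
        R = pow F r (suc j)
        Q = q^ j
        s = (c * c') * (R * (q * Q))
        s≈1 : s ≈ 1#
        s≈1 = trans (*-cong (⁻¹-inverse c c≉0) (pow-inverse (suc j) rq)) (*-identityʳ 1#)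

  -- All three facts about Φ^(1) used by the theorem are statements about these coefficients,
  -- with  Z = q^{m+l}  recording the total degree.
  module Coefficients (q : Carrier) (q-regular : ∀ j → ¬ (poch F q q (suc j) ≈ 0#))
                      (a b b' : Carrier) (m l : ℕ) where
    open QCalculus q
    open import Algebra.Properties.CommutativeSemigroup *-commutativeSemigroup
      using (x∙yz≈y∙xz; x∙yz≈xz∙y; x∙yz≈yx∙z)

    coeff : Carrier → Carrier
    coeff d = Φ1 F q a b b' d m l

    Z : Carrier
    Z = q^ m * q^ l

    numerator : Carrier
    numerator = ⟨ a ⟩ (m +ℕ l) * ⟨ b ⟩ m * ⟨ b' ⟩ l

    factorials : Carrier
    factorials = ⟨ q ⟩ m * ⟨ q ⟩ l

    factorials≉0 : ¬ (factorials ≈ 0#)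
    factorials≉0 = nonzero-* (q-factorial-nonzero q-regular m) (q-factorial-nonzero q-regular l)

    coeff-cong : ∀ {d d'} → Regular d → d ≈ d' → coeff d ≈ coeff d'
    coeff-cong reg d≈d' = *-congˡ (inverse-cong (nonzero-* factorials≉0 (reg (m +ℕ l)))
                                                (*-congˡ (poch-cong (m +ℕ l) d≈d')))

    dilation-factor : ∀ k → pow F (q^ k) m * pow F (q^ k) l ≈ pow F Z k
    dilation-factor k = trans (*-cong (pow-swap q k m) (pow-swap q k l)) (sym (pow-distrib (q^ m) (q^ l) k))

    -- Contiguity in the lower parameter:  coeff(dq) (1 - dZ) = (1 - d) coeff(d),
    -- both sides being numerator (1 - d) / (factorials (dq; q)_{m+l}) by  poch-first.
    contiguity : ∀ {d} → Regular d → coeff (d * q) * (1# - d * Z) ≈ (1# - d) * coeff d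
    contiguity {d} reg = begin
      numerator * A ⁻¹ * (1# - d * Z)   ≈⟨ *-assoc _ _ _ ⟩
      numerator * (A ⁻¹ * (1# - d * Z)) ≈⟨ *-congˡ (trans (*-comm _ _) (cross-multiply A≉0 B≉0 cross)) ⟩
      numerator * ((1# - d) * B ⁻¹)     ≈⟨ x∙yz≈y∙xz _ _ _ ⟩
      (1# - d) * (numerator * B ⁻¹)     ∎
      where
      N = m +ℕ l
      A = factorials * ⟨ d * q ⟩ N
      B = factorials * ⟨ d ⟩ N
      A≉0 = nonzero-* factorials≉0 (regular-q reg N)
      B≉0 = nonzero-* factorials≉0 (reg N)
      cross : (1# - d * Z) * B ≈ (1# - d) * A
      cross = begin
        (1# - d * Z) * (factorials * ⟨ d ⟩ N)     ≈⟨ *-congʳ (+-congˡ (-‿cong (*-congˡ (pow-+ q m l)))) ⟨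
        (1# - d * q^ N) * (factorials * ⟨ d ⟩ N)  ≈⟨ solve 3 (λ u f p → u :* (f :* p) := f :* (p :* u))
                                                       refl (1# - d * q^ N) factorials (⟨ d ⟩ N) ⟩
        factorials * ⟨ d ⟩ suc N                  ≈⟨ *-congˡ (poch-first d N) ⟩
        factorials * ((1# - d) * ⟨ d * q ⟩ N)     ≈⟨ x∙yz≈y∙xz _ _ _ ⟩
        (1# - d) * A                              ∎

    contiguity-iterated : ∀ n {d} → Regular d → coeff (d * q^ n) * ⟨ d * Z ⟩ n ≈ ⟨ d ⟩ n * coeff d
    contiguity-iterated zero    {d} reg =
      trans (*-identityʳ _) (trans (coeff-cong (regular-shift 0 reg) (*-identityʳ d)) (sym (*-identityˡ _)))
    contiguity-iterated (suc n) {d} reg = begin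
      coeff (d * (q * q^ n)) * (⟨ d * Z ⟩ n * (1# - d * Z * q^ n))
        ≈⟨ *-cong (coeff-cong (regular-shift (suc n) reg) regroup-q) (*-congˡ (+-congˡ (-‿cong regroup-Z))) ⟩
      coeff (dₙ * q) * (⟨ d * Z ⟩ n * (1# - dₙ * Z))
        ≈⟨ x∙yz≈xz∙y _ _ _ ⟩
      coeff (dₙ * q) * (1# - dₙ * Z) * ⟨ d * Z ⟩ n
        ≈⟨ *-congʳ (contiguity (regular-shift n reg)) ⟩
      (1# - dₙ) * coeff dₙ * ⟨ d * Z ⟩ n
        ≈⟨ *-assoc _ _ _ ⟩
      (1# - dₙ) * (coeff dₙ * ⟨ d * Z ⟩ n)
        ≈⟨ *-congˡ (contiguity-iterated n reg) ⟩
      (1# - dₙ) * (⟨ d ⟩ n * coeff d)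
        ≈⟨ x∙yz≈yx∙z _ _ _ ⟩
      ⟨ d ⟩ suc n * coeff d ∎
      where
      dₙ = d * q^ n
      regroup-q : d * (q * q^ n) ≈ dₙ * q
      regroup-q = solve 3 (λ d q x → d :* (q :* x) := d :* x :* q) refl d q (q^ n)
      regroup-Z : d * Z * q^ n ≈ dₙ * Z
      regroup-Z = solve 3 (λ d Z x → d :* Z :* x := d :* x :* Z) refl d Z (q^ n)

    -- Second identity of the theorem, coefficientwise (raising c to c q^n):
    -- the coefficients G_k = coeff(c q^k) satisfy the hypothesis of  raising-expansion
    -- by contiguity.
    raising : ∀ c n → Regular c →
      coeff (c * q^ n) ≈
      sumₛ F n (λ k → _·ₛ_ F (qbinom F q n k * pow F c k * q^ (2 *ℕ (k C 2)) * ⟨ c * q^ k ⟩ (n ∸ k))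
                             (dilate F (q^ k) (Φ1 F q a b b' (c * q^ k)))) m l
    raising c n reg = begin
      G n                                                                  ≈⟨ raising-expansion Z n G c recurrence ⟩
      ∑ n (λ k → gauss n k * (raising-weight n c k * (pow F Z k * G k)))  ≈⟨ ∑-cong n term ⟩
      ∑ n (λ k → (qbinom F q n k * pow F c k * q^ (2 *ℕ (k C 2)) * ⟨ c * q^ k ⟩ (n ∸ k))
                   * (pow F (q^ k) m * pow F (q^ k) l * G k))             ≈⟨ sumₛ-coefficient n _ m l ⟨
      _                                                                    ∎
      where
      G : ℕ → Carrier
      G k = coeff (c * q^ k)
      recurrence : ∀ j → G (suc j) * (1# - c * q^ j * Z) ≈ (1# - c * q^ j) * G j
      recurrence j = trans (*-congʳ (coeff-cong (regular-shift (suc j) reg) (x∙yz≈xz∙y c q (q^ j))))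
                           (contiguity (regular-shift j reg))
      term : ∀ k → k ≤ n → gauss n k * (raising-weight n c k * (pow F Z k * G k)) ≈
             (qbinom F q n k * pow F c k * q^ (2 *ℕ (k C 2)) * ⟨ c * q^ k ⟩ (n ∸ k)) * (pow F (q^ k) m * pow F (q^ k) l * G k)
      term k k≤n = begin
        gauss n k * ((ck * E * Pk) * (pow F Z k * G k))  ≈⟨ solve 6 (λ g ck E Pk X Y → g :* ((ck :* E :* Pk) :* (X :* Y))
                                                                    := (g :* ck :* E :* Pk) :* (X :* Y))
                                                               refl (gauss n k) ck E Pk (pow F Z k) (G k) ⟩
        (gauss n k * ck * E * Pk) * (pow F Z k * G k)    ≈⟨ *-cong (*-congʳ (*-congʳ (*-congʳ (sym (qbinom≈gauss q-regular n k k≤n)))))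
                                                                   (*-congʳ (sym (dilation-factor k))) ⟩
        (qbinom F q n k * ck * E * Pk) * (pow F (q^ k) m * pow F (q^ k) l * G k) ∎
        where
        ck = pow F c k
        E = q^ (2 *ℕ (k C 2))
        Pk = ⟨ c * q^ k ⟩ (n ∸ k)

    -- First identity of the theorem, coefficientwise (lowering c to c q^{-n}):
    -- with c' = c q^{-n} and K = (q/c; q)_n,  iterated contiguity from c' gives
    -- (c'; q)_n coeff(c') = coeff(c) (c'Z; q)_n,  lowering-product rewrites (c'Z; q)_n K,
    -- and the q-binomial theorem turns the remaining product into the sum.
    lowering : ¬ (q ≈ 0#) → ∀ c n → ¬ (c ≈ 0#) → Regular (c * pow F (q ⁻¹) n) →
      ¬ (⟨ q * c ⁻¹ ⟩ n ≈ 0#) →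
      coeff (c * pow F (q ⁻¹) n) ≈
      ⟨ q * c ⁻¹ ⟩ n ⁻¹ *
      sumₛ F n (λ k → _·ₛ_ F (qbinom F q n k * pow F ((- c) ⁻¹) (n ∸ k) * q^ ((suc n ∸ k) C 2))
                             (dilate F (q^ k) (Φ1 F q a b b' c))) m l
    lowering q≉0 c n c≉0 reg' K≉0 = solve-for K≉0 (begin
      K * coeff c'             ≈⟨ cancelˡ (reg' n) transported ⟩
      ∏ n f * coeff c          ≈⟨ expansion ⟨
      _                        ∎)
      where
      r = q ⁻¹
      c' = c * pow F r n
      K = ⟨ q * c ⁻¹ ⟩ n
      e = (- c) ⁻¹
      f : ℕ → Carrier
      f j = Z + e * q^ suc j

      rq : r * q ≈ 1#
      rq = ⁻¹-inverseˡ q q≉0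

      c'qⁿ≈c : c' * q^ n ≈ c
      c'qⁿ≈c = trans (*-assoc c _ _) (trans (*-congˡ (pow-inverse n rq)) (*-identityʳ c))

      transported : ⟨ c' ⟩ n * (K * coeff c') ≈ ⟨ c' ⟩ n * (∏ n f * coeff c)
      transported = begin
        ⟨ c' ⟩ n * (K * coeff c')          ≈⟨ x∙yz≈y∙xz _ _ _ ⟩
        K * (⟨ c' ⟩ n * coeff c')          ≈⟨ *-congˡ (contiguity-iterated n reg') ⟨
        K * (coeff (c' * q^ n) * ⟨ c' * Z ⟩ n)
                                           ≈⟨ *-congˡ (*-congʳ (coeff-cong (regular-shift n reg') c'qⁿ≈c)) ⟩
        K * (coeff c * ⟨ c' * Z ⟩ n)       ≈⟨ solve 3 (λ k x y → k :* (x :* y) := y :* k :* x) refl K (coeff c) (⟨ c' * Z ⟩ n) ⟩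
        ⟨ c' * Z ⟩ n * K * coeff c         ≈⟨ *-congʳ (lowering-product rq c≉0 Z n) ⟨
        ⟨ c' ⟩ n * ∏ n f * coeff c         ≈⟨ *-assoc _ _ _ ⟩
        ⟨ c' ⟩ n * (∏ n f * coeff c)       ∎

      expansion : sumₛ F n (λ k → _·ₛ_ F (qbinom F q n k * pow F e (n ∸ k) * q^ ((suc n ∸ k) C 2))
                                         (dilate F (q^ k) (Φ1 F q a b b' c))) m l
                  ≈ ∏ n f * coeff c
      expansion = begin
        _                                                       ≈⟨ sumₛ-coefficient n _ m l ⟩
        ∑ n (λ k → (qbinom F q n k * pow F e (n ∸ k) * q^ ((suc n ∸ k) C 2))
                     * (pow F (q^ k) m * pow F (q^ k) l * coeff c)) ≈⟨ ∑-cong n term ⟩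
        ∑ n (λ k → gauss n k * binomial-term e Z n k * coeff c) ≈⟨ ∑-*ʳ n _ _ ⟨
        ∑ n (λ k → gauss n k * binomial-term e Z n k) * coeff c ≈⟨ *-congʳ (q-binomial-theorem e Z n) ⟨
        ∏ n f * coeff c                                         ∎
        where
        term : ∀ k → k ≤ n → (qbinom F q n k * pow F e (n ∸ k) * q^ ((suc n ∸ k) C 2))
                               * (pow F (q^ k) m * pow F (q^ k) l * coeff c)
                             ≈ gauss n k * binomial-term e Z n k * coeff c
        term k k≤n = begin
          (qbinom F q n k * E * Q) * (pow F (q^ k) m * pow F (q^ k) l * coeff c)
            ≈⟨ *-cong (*-congʳ (*-congʳ (qbinom≈gauss q-regular n k k≤n))) (*-congʳ (dilation-factor k)) ⟩
          (gauss n k * E * Q) * (pow F Z k * coeff c)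
            ≈⟨ solve 5 (λ g E Q X Y → (g :* E :* Q) :* (X :* Y) := g :* (E :* Q :* X) :* Y)
                     refl (gauss n k) E Q (pow F Z k) (coeff c) ⟩
          gauss n k * binomial-term e Z n k * coeff c ∎
          where
          E = pow F e (n ∸ k)
          Q = q^ ((suc n ∸ k) C 2)

theorem5 : ∀ {ℓ₁ ℓ₂ : Level} (F : Field ℓ₁ ℓ₂) →
    let open Field F in
    (q a b b' c : Carrier) (n : ℕ) → 1 ≤ n →
    ¬ (q ≈ 0#) → ¬ (c ≈ 0#) →
    (∀ j → ¬ (poch F q q (suc j) ≈ 0#)) →
    (∀ N → ¬ (poch F c q N ≈ 0#)) →
    (∀ N → ¬ (poch F (c * pow F (q ⁻¹) n) q N ≈ 0#)) →
    ¬ (poch F (q * c ⁻¹) q n ≈ 0#) →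
    _≈ₛ_ F (Φ1 F q a b b' (c * pow F (q ⁻¹) n))
      (_·ₛ_ F ((poch F (q * c ⁻¹) q n) ⁻¹)
        (sumₛ F n (λ k → _·ₛ_ F
          (qbinom F q n k * pow F ((- c) ⁻¹) (n ∸ k) * pow F q ((suc n ∸ k) C 2))
          (dilate F (pow F q k) (Φ1 F q a b b' c)))))
    ×
    _≈ₛ_ F (Φ1 F q a b b' (c * pow F q n))
      (sumₛ F n (λ k → _·ₛ_ F
          (qbinom F q n k * pow F c k * pow F q (2 *ℕ (k C 2)) * poch F (c * pow F q k) q (n ∸ k))
          (dilate F (pow F q k) (Φ1 F q a b b' (c * pow F q k)))))
theorem5 F q a b b' c n _ q≉0 c≉0 q-regular c-regular c'-regular K≉0 =
  (λ m l → Coefficients.lowering q q-regular a b b' m l q≉0 c n c≉0 c'-regular K≉0) ,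
  (λ m l → Coefficients.raising q q-regular a b b' m l c n c-regular)
  where open FieldTheory F
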